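{- Let $i$ and $i'$ be distinct vertices in a quiver $Q$ with large weights, and let $Q'=\mu[i](Q)$. Consider the conditions on a pair $(P,j)$ (quiver, vertex): (A) $j$ is an ascent in every cyclic 3-vertex full subquiver of $P$ containing $j$; (B) $j$ is not a sink or source in $P$; (C) $j$ is not the apex of a vortex in $P$; and (G) $P$ has a global descent at a vertex different from $j$; (V) $P$ is vortex-free. If $(Q,i)$ satisfies (A), (B), (C) (resp. (G), (V)), then $(Q',i')$ satisfies the same conditions; in fact $Q'$ has global descent at $i$. Moreover, $|b_{uv}(Q)|\le|b_{uv}(Q')|$ for all vertices $u,v$, with at least one strict inequality.
   Context: Quivers are finite directed multigraphs without loops or oriented 2-cycles, encoded by skew-symmetric $B(Q)=(b_{ij})$; mutation at $k$: $b'_{ij}=-b_{ij}$ if $k\in\{i,j\}$, else $b'_{ij}=b_{ij}+\tfrac12(|b_{ik}|b_{kj}+b_{ik}|b_{kj}|)$. Large weights: $|b_{uv}|\ge 2$ for all $u\ne v$. Write $u\dashrightarrow v$ if $b_{uv}\ge 0$; a sink (source) is a vertex $j$ with $v\dashrightarrow j$ ($j\dashrightarrow v$) for all other $v$. Full subquiver = induced subgraph. A 3-vertex quiver is cyclic if it contains an oriented 3-cycle. In a 3-vertex quiver on $\{i,j,k\}$, $i$ is an ascent (descent) if $|b_{jk}(\mu[i](Q))|>|b_{jk}(Q)|$ (resp. $<$). A quiver has a global descent at $v$ if it contains at least one cyclic 3-vertex full subquiver and every such subquiver has descent at $v$. A vortex is a 4-vertex quiver with all weights nonzero, one vertex (the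 apex) a sink or source, and the remaining three supporting a cyclic 3-vertex subquiver; a quiver is vortex-free if none of its full 4-vertex subquivers is a vortex. -}

module Defs where

open import Data.Nat as ℕ using (ℕ)
open import Data.Integer using (ℤ; +_; -_; _+_; _*_; ∣_∣; _/ℕ_; _<_; _≤_; _>_)
open import Data.Fin using (Fin; _≟_)
open import Data.Product using (Σ; _×_; ∃; ∃-syntax; _,_)
open import Data.Sum using (_⊎_)
open import Relation.Nullary using (¬_; yes; no)
open import Relation.Binary.PropositionalEquality using (_≡_; _≢_)

-- A quiver on vertex set Fin n, encoded by its exchange matrix b_{uv} = B u v.
Matrix : ℕ → Set
Matrix n = Fin n → Fin n → ℤ

-- Skew-symmetry (this also forces b_{uu} = 0, i.e. no loops; no oriented
-- 2-cycles is automatic in the matrix encoding).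
SkewSymmetric : ∀ {n} → Matrix n → Set
SkewSymmetric B = ∀ u v → B u v ≡ - B v u

LargeWeights : ∀ {n} → Matrix n → Set
LargeWeights B = ∀ u v → u ≢ v → 2 ℕ.≤ ∣ B u v ∣

mutate : ∀ {n} → Fin n → Matrix n → Matrix n
mutate k B i j with i ≟ k | j ≟ k
... | yes _ | _     = - B i j
... | no _  | yes _ = - B i j
... | no _  | no _  =
  B i j + ((+ ∣ B i k ∣) * B k j + B i k * (+ ∣ B k j ∣)) /ℕ 2

_⇢_within_ : ∀ {n} → Fin n → Fin n → Matrix n → Set
u ⇢ v within B = + 0 ≤ B u v

Distinct3 : ∀ {n} → Fin n → Fin n → Fin n → Set
Distinct3 x y z = x ≢ y × y ≢ z × x ≢ z

Distinct4 : ∀ {n} → Fin n → Fin n → Fin n → Fin n → Set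
Distinct4 a x y z = a ≢ x × a ≢ y × a ≢ z × Distinct3 x y z

Cyclic : ∀ {n} → Matrix n → Fin n → Fin n → Fin n → Set
Cyclic B x y z =
  (+ 0 < B x y × + 0 < B y z × + 0 < B z x)
  ⊎ (+ 0 < B y x × + 0 < B z y × + 0 < B x z)

-- In the 3-vertex full subquiver on {a, b, c}, a is an ascent / descent.
-- (b_bc of the mutated full subquiver equals b_bc of the mutated quiver,
-- since mutation at a only involves entries between vertices of the subquiver.)
Ascent : ∀ {n} → Matrix n → Fin n → Fin n → Fin n → Set
Ascent B a b c = ∣ B b c ∣ ℕ.< ∣ mutate a B b c ∣

Descent : ∀ {n} → Matrix n → Fin n → Fin n → Fin n → Set
Descent B a b c = ∣ mutate a B b c ∣ ℕ.< ∣ B b c ∣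

HasDescentAt : ∀ {n} → Matrix n → Fin n → Fin n → Fin n → Fin n → Set
HasDescentAt B v x y z =
  (v ≡ x × Descent B x y z) ⊎ (v ≡ y × Descent B y x z) ⊎ (v ≡ z × Descent B z x y)

GlobalDescent : ∀ {n} → Matrix n → Fin n → Set
GlobalDescent B v =
  (∃[ x ] ∃[ y ] ∃[ z ] (Distinct3 x y z × Cyclic B x y z))
  × (∀ x y z → Distinct3 x y z → Cyclic B x y z → HasDescentAt B v x y z)

IsSink : ∀ {n} → Matrix n → Fin n → Set
IsSink B j = ∀ v → v ≢ j → v ⇢ j within B

IsSource : ∀ {n} → Matrix n → Fin n → Set
IsSource B j = ∀ v → v ≢ j → j ⇢ v within B

IsVortex : ∀ {n} → Matrix n → Fin n → Fin n → Fin n → Fin n → Set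
IsVortex B a x y z =
  (B a x ≢ + 0 × B a y ≢ + 0 × B a z ≢ + 0 × B x y ≢ + 0 × B y z ≢ + 0 × B x z ≢ + 0)
  × ((x ⇢ a within B × y ⇢ a within B × z ⇢ a within B)
     ⊎ (a ⇢ x within B × a ⇢ y within B × a ⇢ z within B))
  × Cyclic B x y z

IsVortexApex : ∀ {n} → Matrix n → Fin n → Set
IsVortexApex B j = ∃[ x ] ∃[ y ] ∃[ z ] (Distinct4 j x y z × IsVortex B j x y z)

VortexFree : ∀ {n} → Matrix n → Set
VortexFree B = ∀ a x y z → Distinct4 a x y z → ¬ IsVortex B a x y z

CondA : ∀ {n} → Matrix n → Fin n → Set
CondA B j = ∀ u v → Distinct3 j u v → Cyclic B j u v → Ascent B j u v

CondB : ∀ {n} → Matrix n → Fin n → Set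
CondB B j = ¬ IsSink B j × ¬ IsSource B j

CondC : ∀ {n} → Matrix n → Fin n → Set
CondC B j = ¬ IsVortexApex B j

CondG : ∀ {n} → Matrix n → Fin n → Set
CondG B j = ∃[ v ] (v ≢ j × GlobalDescent B v)

CondV : ∀ {n} → Matrix n → Fin n → Set
CondV B j = VortexFree B

CondsABC : ∀ {n} → Matrix n → Fin n → Set
CondsABC B j = CondA B j × CondB B j × CondC B j

CondsGV : ∀ {n} → Matrix n → Fin n → Set
CondsGV B j = CondG B j × CondV B j

WeightsIncrease : ∀ {n} → Matrix n → Matrix n → Set
WeightsIncrease B B' =
  (∀ u v → ∣ B u v ∣ ℕ.≤ ∣ B' u v ∣) × (∃[ u ] ∃[ v ] (∣ B u v ∣ ℕ.< ∣ B' u v ∣))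

-- Mutating at i reverses the arrows at i and changes b_uv (u, v ≠ i) by b_ui b_iv exactly when
-- u → i → v or v → i → u is a path, and not at all otherwise. By (A) every such change increases
-- |b_uv|: if b_uv opposes the path, then u, i, v form a cyclic triangle with ascent at i. So no weight
-- decreases, and the path through i provided by (B) gives a strict increase.
-- In Q′ = μ_i(Q), an arrow between vertices other than i never leads from an out-neighbour of i in Q
-- to an in-neighbour, so a 3-cycle of Q′ avoiding i lies on one side of i; there Q and Q′ agree and
-- i would be the apex of a vortex of Q, contradicting (C). Hence every cyclic triangle of Q′ contains
-- i, and as mutating back at i undoes an ascent, i is a descent of it: Q′ has global descent at i.
-- Every path through i in Q′ closes to a 3-cycle, which rules out vortices in Q′.
-- With large weights a descent at one vertex of a cyclic triangle forces ascents at the other two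
-- (|r − ps| < r with p, s ≥ 2 gives s < pr − s), so (G) and (V) imply (A), (B) and (C). This yields
-- (A), (B), (C) for (Q′, i′) and reduces the second implication to the first.

module Submission where

open import Defs
open import Data.Nat as ℕ using (ℕ; zero; suc; z≤n; s≤s)
import Data.Nat.Properties as ℕP
import Data.Nat.DivMod as ℕD
open import Data.Integer
  using (ℤ; +_; -_; _+_; _*_; ∣_∣; _/ℕ_; _<_; _≤_; _⊖_; +[1+_]; -[1+_]; +<+; -<+; +≤+)
open import Data.Integer.Properties
  using ( neg-involutive; neg-distrib-+; neg-mono-<; +-identityʳ; +-assoc; +-inverseʳ
        ; ∣-i∣≡∣i∣; ⊖-≥; ∣⊖∣-≤; ∣⊖∣-≰; ∣m⊖n∣≡∣n⊖m∣; n⊖n≡0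
        ; <⇒≤; <⇒≱; ≤∧≢⇒<; ≰⇒>)
  renaming (_≤?_ to _≤ℤ?_)
open import Data.Fin using (Fin; _≟_)
open import Data.Fin.Properties using (¬∀⟶∃¬)
open import Data.Product using (_×_; ∃-syntax; _,_; proj₁; proj₂)
open import Data.Sum using (_⊎_; inj₁; inj₂; [_,_]′)
open import Data.Empty using (⊥; ⊥-elim)
open import Relation.Nullary using (¬_; Dec; yes; no)
open import Relation.Nullary.Decidable using (¬?; _→-dec_)
open import Relation.Binary.PropositionalEquality

-- Integer arithmetic

∣∣<-congˡ : ∀ {s s′ m} → s ≡ s′ → ∣ s ∣ ℕ.< m → ∣ s′ ∣ ℕ.< m
∣∣<-congˡ refl h = h

∣∣<-congʳ : ∀ {m t t′} → t ≡ t′ → m ℕ.< ∣ t ∣ → m ℕ.< ∣ t′ ∣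
∣∣<-congʳ refl h = h

nonzero-sign : ∀ x → x ≢ + 0 → + 0 < x ⊎ x < + 0
nonzero-sign (+ zero)  x≢0 = ⊥-elim (x≢0 refl)
nonzero-sign +[1+ m ] _   = inj₁ (+<+ (s≤s z≤n))
nonzero-sign -[1+ m ] _   = inj₂ -<+

∣i∣<∣i+j∣ : ∀ {i j} → + 0 ≤ i → + 0 < j → ∣ i ∣ ℕ.< ∣ i + j ∣
∣i∣<∣i+j∣ {+ m} {+[1+ n ]} _ _ = ℕP.m<m+n m (s≤s z≤n)
∣i∣<∣i+j∣ {+ m} {+ zero}   _ (+<+ ())

n<∣m⊖n∣⇒0<m⊖n : ∀ {m n} → n ℕ.< ∣ m ⊖ n ∣ → + 0 < m ⊖ n
n<∣m⊖n∣⇒0<m⊖n {m} {n} h with m ℕ.≤? n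
... | yes m≤n = ⊥-elim (ℕP.<⇒≱ h (subst (ℕ._≤ n) (sym (∣⊖∣-≤ m≤n)) (ℕP.m∸n≤m n m)))
... | no  m≰n rewrite ⊖-≥ (ℕP.<⇒≤ (ℕP.≰⇒> m≰n)) = +<+ (ℕP.m<n⇒0<n∸m (ℕP.≰⇒> m≰n))

∣i∣<∣i+j∣⇒0<i+j : ∀ {i j} → + 0 < j → ∣ i ∣ ℕ.< ∣ i + j ∣ → + 0 < i + j
∣i∣<∣i+j∣⇒0<i+j {+ m}      {+[1+ n ]} _ _ = +<+ (ℕP.<-≤-trans (s≤s z≤n) (ℕP.m≤n+m (suc n) m))
∣i∣<∣i+j∣⇒0<i+j { -[1+ m ]} {+[1+ n ]} _ h = n<∣m⊖n∣⇒0<m⊖n {suc n} h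
∣i∣<∣i+j∣⇒0<i+j {_}        {+ zero}   (+<+ ()) _

m+m≡m*2 : ∀ m → m ℕ.+ m ≡ m ℕ.* 2
m+m≡m*2 m = trans (cong (m ℕ.+_) (sym (ℕP.+-identityʳ m))) (ℕP.*-comm 2 m)

[m+m]/2≡m : ∀ m → (m ℕ.+ m) ℕ./ 2 ≡ m
[m+m]/2≡m m = trans (cong (ℕ._/ 2) (m+m≡m*2 m)) (ℕD.m*n/n≡m m 2)

[m+m]%2≡0 : ∀ m → (m ℕ.+ m) ℕ.% 2 ≡ 0
[m+m]%2≡0 m = trans (cong (ℕ._% 2) (m+m≡m*2 m)) (ℕD.m*n%n≡0 m 2)

[i+i]/ℕ2≡i : ∀ i → (i + i) /ℕ 2 ≡ i
[i+i]/ℕ2≡i (+ m)    = cong +_ ([m+m]/2≡m m)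
[i+i]/ℕ2≡i -[1+ m ] = halve (suc (m ℕ.+ m)) (cong suc (sym (ℕP.+-suc m m)))
  where
  halve : ∀ k → suc k ≡ suc m ℕ.+ suc m → -[1+ k ] /ℕ 2 ≡ -[1+ m ]
  halve k k≡ with suc k ℕ.% 2 in even
  ... | zero  = cong (λ t → - + t) (trans (cong (ℕ._/ 2) k≡) ([m+m]/2≡m (suc m)))
  ... | suc _ = ⊥-elim (ℕP.1+n≢0 (trans (sym even) (trans (cong (ℕ._% 2) k≡) ([m+m]%2≡0 (suc m)))))

m+m≤k*m : ∀ {k} m → 2 ℕ.≤ k → m ℕ.+ m ℕ.≤ k ℕ.* m
m+m≤k*m m 2≤k =
  ℕP.≤-trans (ℕP.≤-reflexive (cong (m ℕ.+_) (sym (ℕP.+-identityʳ m)))) (ℕP.*-monoˡ-≤ m 2≤k)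

m+m<n+n⇒m<n : ∀ {m n} → m ℕ.+ m ℕ.< n ℕ.+ n → m ℕ.< n
m+m<n+n⇒m<n h = ℕP.≰⇒> (λ n≤m → ℕP.<⇒≱ h (ℕP.+-mono-≤ n≤m n≤m))

∣o⊖k∣<o⇒k<o+o : ∀ {o k} → ∣ o ⊖ k ∣ ℕ.< o → k ℕ.< o ℕ.+ o
∣o⊖k∣<o⇒k<o+o {o} {k} h with k ℕ.≤? o
... | yes k≤o = ℕP.≤-<-trans k≤o (ℕP.m<m+n o (ℕP.≤-<-trans z≤n h))
... | no  k≰o = ℕP.≤-<-trans (ℕP.m≤n+m∸n k o) (ℕP.+-monoʳ-< o (subst (ℕ._< o) (∣⊖∣-≰ k≰o) h))

∣o⊖m*n∣<o⇒n<∣m*o⊖n∣ : ∀ {m n o} → 2 ℕ.≤ m →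
                      ∣ o ⊖ m ℕ.* n ∣ ℕ.< o → n ℕ.< ∣ m ℕ.* o ⊖ n ∣
∣o⊖m*n∣<o⇒n<∣m*o⊖n∣ {m} {n} {o} 2≤m h =
  subst (n ℕ.<_) (cong ∣_∣ (sym (⊖-≥ (ℕP.m+n≤o⇒m≤o n (ℕP.<⇒≤ n+n<m*o)))))
        (ℕP.m+n≤o⇒m≤o∸n (suc n) n+n<m*o)
  where
  n<o : n ℕ.< o
  n<o = m+m<n+n⇒m<n (ℕP.≤-<-trans (m+m≤k*m n 2≤m) (∣o⊖k∣<o⇒k<o+o h))
  n+n<m*o : n ℕ.+ n ℕ.< m ℕ.* o
  n+n<m*o = ℕP.<-≤-trans (ℕP.+-mono-< n<o n<o) (m+m≤k*m o 2≤m)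

-- The mutation term

pathWeight : ℤ → ℤ → ℤ
pathWeight +[1+ m ] +[1+ n ] = + (suc m ℕ.* suc n)
pathWeight -[1+ m ] -[1+ n ] = - + (suc m ℕ.* suc n)
pathWeight _        _        = + 0

[∣x∣y+x∣y∣]/ℕ2≡pathWeight : ∀ x y → ((+ ∣ x ∣) * y + x * (+ ∣ y ∣)) /ℕ 2 ≡ pathWeight x y
[∣x∣y+x∣y∣]/ℕ2≡pathWeight (+ zero)  y         = refl
[∣x∣y+x∣y∣]/ℕ2≡pathWeight +[1+ m ]  (+ zero)  rewrite ℕP.*-zeroʳ m = refl
[∣x∣y+x∣y∣]/ℕ2≡pathWeight -[1+ m ]  (+ zero)  rewrite ℕP.*-zeroʳ m = refl
[∣x∣y+x∣y∣]/ℕ2≡pathWeight +[1+ m ] +[1+ n ] = [i+i]/ℕ2≡i (+ (suc m ℕ.* suc n))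
[∣x∣y+x∣y∣]/ℕ2≡pathWeight -[1+ m ] -[1+ n ] = [i+i]/ℕ2≡i (- + (suc m ℕ.* suc n))
[∣x∣y+x∣y∣]/ℕ2≡pathWeight +[1+ m ] -[1+ n ] = cong (_/ℕ 2) (n⊖n≡0 (suc m ℕ.* suc n))
[∣x∣y+x∣y∣]/ℕ2≡pathWeight -[1+ m ] +[1+ n ] = cong (_/ℕ 2) (n⊖n≡0 (suc m ℕ.* suc n))

pathWeight-neg : ∀ x y → pathWeight (- x) (- y) ≡ - pathWeight x y
pathWeight-neg (+ zero)  y         = refl
pathWeight-neg +[1+ m ]  (+ zero)  = refl
pathWeight-neg +[1+ m ]  +[1+ n ]  = refl
pathWeight-neg +[1+ m ]  -[1+ n ]  = refl
pathWeight-neg -[1+ m ]  (+ zero)  = refl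
pathWeight-neg -[1+ m ]  +[1+ n ]  = refl
pathWeight-neg -[1+ m ]  -[1+ n ]  = sym (neg-involutive _)

pathWeight-comm : ∀ x y → pathWeight x y ≡ pathWeight y x
pathWeight-comm +[1+ m ] +[1+ n ] = cong +_ (ℕP.*-comm (suc m) (suc n))
pathWeight-comm -[1+ m ] -[1+ n ] = cong (λ k → - + k) (ℕP.*-comm (suc m) (suc n))
pathWeight-comm (+ zero) (+ zero) = refl
pathWeight-comm (+ zero) +[1+ n ] = refl
pathWeight-comm (+ zero) -[1+ n ] = refl
pathWeight-comm +[1+ m ] (+ zero) = refl
pathWeight-comm +[1+ m ] -[1+ n ] = refl
pathWeight-comm -[1+ m ] (+ zero) = refl
pathWeight-comm -[1+ m ] +[1+ n ] = refl

pathWeight-pos : ∀ {x y} → + 0 < x → + 0 < y → + 0 < pathWeight x y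
pathWeight-pos {+[1+ m ]} {+[1+ n ]} _ _ = +<+ (s≤s z≤n)
pathWeight-pos {+ zero} (+<+ ()) _
pathWeight-pos {+[1+ m ]} {+ zero} _ (+<+ ())

pathWeight-≥0-≤0 : ∀ {x y} → + 0 ≤ x → y ≤ + 0 → pathWeight x y ≡ + 0
pathWeight-≥0-≤0 {+ zero}            _ _ = refl
pathWeight-≥0-≤0 {+[1+ m ]} {+ zero}  _ _ = refl
pathWeight-≥0-≤0 {+[1+ m ]} { -[1+ n ]} _ _ = refl
pathWeight-≥0-≤0 {+[1+ m ]} {+[1+ n ]} _ (+≤+ ())

pathWeight-≤0-≥0 : ∀ {x y} → x ≤ + 0 → + 0 ≤ y → pathWeight x y ≡ + 0
pathWeight-≤0-≥0 {x} {y} x≤0 0≤y = trans (pathWeight-comm x y) (pathWeight-≥0-≤0 0≤y x≤0)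

pathWeight-cases : ∀ x y → (+ 0 < x × + 0 < y) ⊎ (x < + 0 × y < + 0) ⊎ pathWeight x y ≡ + 0
pathWeight-cases +[1+ m ] +[1+ n ] = inj₁ (+<+ (s≤s z≤n) , +<+ (s≤s z≤n))
pathWeight-cases -[1+ m ] -[1+ n ] = inj₂ (inj₁ (-<+ , -<+))
pathWeight-cases (+ zero) y        = inj₂ (inj₂ refl)
pathWeight-cases +[1+ m ] (+ zero) = inj₂ (inj₂ refl)
pathWeight-cases +[1+ m ] -[1+ n ] = inj₂ (inj₂ refl)
pathWeight-cases -[1+ m ] (+ zero) = inj₂ (inj₂ refl)
pathWeight-cases -[1+ m ] +[1+ n ] = inj₂ (inj₂ refl)

-- P, R, S are the weights of an oriented triangle k → a → b → k.
triangle-descent⇒ascents : ∀ {P R S} → + 0 < P → + 0 < R → + 0 < S →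
  2 ℕ.≤ ∣ P ∣ → 2 ℕ.≤ ∣ S ∣ →
  ∣ R + pathWeight (- P) (- S) ∣ ℕ.< ∣ R ∣ →
  ∣ - S ∣ ℕ.< ∣ - S + pathWeight P R ∣ × ∣ P ∣ ℕ.< ∣ P + pathWeight (- S) (- R) ∣
triangle-descent⇒ascents {+[1+ p ]} {+[1+ r ]} {+[1+ s ]} _ _ _ 2≤P 2≤S descent =
  ∣o⊖m*n∣<o⇒n<∣m*o⊖n∣ 2≤P descent ,
  subst (suc p ℕ.<_) (∣m⊖n∣≡∣n⊖m∣ (suc s ℕ.* suc r) (suc p))
        (∣o⊖m*n∣<o⇒n<∣m*o⊖n∣ 2≤S
          (subst (λ k → ∣ suc r ⊖ k ∣ ℕ.< suc r) (ℕP.*-comm (suc p) (suc s)) descent))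
triangle-descent⇒ascents {+ zero} (+<+ ()) _ _ _ _ _
triangle-descent⇒ascents {_} {+ zero} _ (+<+ ()) _ _ _ _
triangle-descent⇒ascents {_} {_} {+ zero} _ _ (+<+ ()) _ _ _

-- Exchange matrices

module _ {n : ℕ} where

  mutate-pivotˡ : ∀ (M : Matrix n) k v → mutate k M k v ≡ - M k v
  mutate-pivotˡ M k v with k ≟ k
  ... | yes _   = refl
  ... | no  k≢k = ⊥-elim (k≢k refl)

  mutate-pivotʳ : ∀ (M : Matrix n) k u → mutate k M u k ≡ - M u k
  mutate-pivotʳ M k u with u ≟ k | k ≟ k
  ... | yes _ | _       = refl
  ... | no  _ | yes _   = refl
  ... | no  _ | no  k≢k = ⊥-elim (k≢k refl)

  mutate-off-pivot : ∀ (M : Matrix n) {k u v} → u ≢ k → v ≢ k →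
                     mutate k M u v ≡ M u v + pathWeight (M u k) (M k v)
  mutate-off-pivot M {k} {u} {v} u≢k v≢k with u ≟ k | v ≟ k
  ... | yes u≡k | _       = ⊥-elim (u≢k u≡k)
  ... | no  _   | yes v≡k = ⊥-elim (v≢k v≡k)
  ... | no  _   | no  _   = cong (_+_ (M u v)) ([∣x∣y+x∣y∣]/ℕ2≡pathWeight (M u k) (M k v))

  ¬all-nonneg⇒∃neg : ∀ (j : Fin n) (f : Fin n → ℤ) →
                     ¬ (∀ v → v ≢ j → + 0 ≤ f v) → ∃[ v ] (f v < + 0)
  ¬all-nonneg⇒∃neg j f ¬all with ¬∀⟶∃¬ n _ (λ v → ¬? (v ≟ j) →-dec (+ 0 ≤ℤ? f v)) ¬all
  ... | v , ¬nonneg = v , ≰⇒> (λ 0≤fv → ¬nonneg (λ _ → 0≤fv))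

  large-mono : ∀ {M M′ : Matrix n} →
               LargeWeights M → (∀ u v → ∣ M u v ∣ ℕ.≤ ∣ M′ u v ∣) → LargeWeights M′
  large-mono large ≤′ u v u≢v = ℕP.≤-trans (large u v u≢v) (≤′ u v)

  ∣M∣≡∣Mᵀ∣ : ∀ {M : Matrix n} → SkewSymmetric M → ∀ u v → ∣ M u v ∣ ≡ ∣ M v u ∣
  ∣M∣≡∣Mᵀ∣ {M} skew u v = trans (cong ∣_∣ (skew u v)) (∣-i∣≡∣i∣ (M v u))

  module _ {M : Matrix n} (skew : SkewSymmetric M) where

    -M≡Mᵀ : ∀ u v → - M u v ≡ M v u
    -M≡Mᵀ u v = trans (cong -_ (skew u v)) (neg-involutive (M v u))

    pos⇒negᵀ : ∀ {u v} → + 0 < M u v → M v u < + 0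
    pos⇒negᵀ {u} {v} p = subst (_< + 0) (-M≡Mᵀ u v) (neg-mono-< p)

    neg⇒posᵀ : ∀ {u v} → M u v < + 0 → + 0 < M v u
    neg⇒posᵀ {u} {v} p = subst (+ 0 <_) (-M≡Mᵀ u v) (neg-mono-< p)

    pos⇒¬nonnegᵀ : ∀ {u v} → + 0 < M u v → ¬ (+ 0 ≤ M v u)
    pos⇒¬nonnegᵀ p = <⇒≱ (pos⇒negᵀ p)

    pos⇒≢ : ∀ {u v} → + 0 < M u v → u ≢ v
    pos⇒≢ p refl = pos⇒¬nonnegᵀ p (<⇒≤ p)

    cyclic⇒distinct : ∀ {x y z} → Cyclic M x y z → Distinct3 x y z
    cyclic⇒distinct (inj₁ (xy , yz , zx)) = pos⇒≢ xy , pos⇒≢ yz , ≢-sym (pos⇒≢ zx)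
    cyclic⇒distinct (inj₂ (yx , zy , xz)) = ≢-sym (pos⇒≢ yx) , ≢-sym (pos⇒≢ zy) , pos⇒≢ xz

    out-neighbour⇒¬sink : ∀ {j v} → + 0 < M j v → ¬ IsSink M j
    out-neighbour⇒¬sink {v = v} jv sink = pos⇒¬nonnegᵀ jv (sink v (≢-sym (pos⇒≢ jv)))

    in-neighbour⇒¬source : ∀ {j u} → + 0 < M u j → ¬ IsSource M j
    in-neighbour⇒¬source {u = u} uj source = pos⇒¬nonnegᵀ uj (source u (pos⇒≢ uj))

    ¬sink⇒out-neighbour : ∀ {j} → ¬ IsSink M j → ∃[ v ] (+ 0 < M j v)
    ¬sink⇒out-neighbour {j} ¬sink with ¬all-nonneg⇒∃neg j (λ v → M v j) ¬sink
    ... | v , vj<0 = v , neg⇒posᵀ vj<0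

    ¬source⇒in-neighbour : ∀ {j} → ¬ IsSource M j → ∃[ u ] (+ 0 < M u j)
    ¬source⇒in-neighbour {j} ¬source with ¬all-nonneg⇒∃neg j (M j) ¬source
    ... | u , ju<0 = u , neg⇒posᵀ ju<0

    mutate-skew : ∀ k → SkewSymmetric (mutate k M)
    mutate-skew k u v = by-cases (u ≟ k) (v ≟ k)
      where
      open ≡-Reasoning
      by-cases : Dec (u ≡ k) → Dec (v ≡ k) → mutate k M u v ≡ - mutate k M v u
      by-cases (yes refl) _ = begin
        mutate u M u v     ≡⟨ mutate-pivotˡ M u v ⟩
        - M u v            ≡⟨ cong -_ (skew u v) ⟩
        - - M v u          ≡⟨ cong -_ (mutate-pivotʳ M u v) ⟨
        - mutate u M v u   ∎
      by-cases (no _) (yes refl) = begin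
        mutate v M u v     ≡⟨ mutate-pivotʳ M v u ⟩
        - M u v            ≡⟨ cong -_ (skew u v) ⟩
        - - M v u          ≡⟨ cong -_ (mutate-pivotˡ M v u) ⟨
        - mutate v M v u   ∎
      by-cases (no u≢k) (no v≢k) = begin
        mutate k M u v                               ≡⟨ mutate-off-pivot M u≢k v≢k ⟩
        M u v + pathWeight (M u k) (M k v)           ≡⟨ cong₂ _+_ (skew u v) reversed ⟩
        - M v u + - pathWeight (M v k) (M k u)       ≡⟨ neg-distrib-+ (M v u) _ ⟨
        - (M v u + pathWeight (M v k) (M k u))       ≡⟨ cong -_ (mutate-off-pivot M v≢k u≢k) ⟨
        - mutate k M v u                             ∎
        where
        reversed : pathWeight (M u k) (M k v) ≡ - pathWeight (M v k) (M k u)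
        reversed = begin
          pathWeight (M u k) (M k v)             ≡⟨ pathWeight-comm (M u k) (M k v) ⟩
          pathWeight (M k v) (M u k)             ≡⟨ cong₂ pathWeight (skew k v) (skew u k) ⟩
          pathWeight (- M v k) (- M k u)         ≡⟨ pathWeight-neg (M v k) (M k u) ⟩
          - pathWeight (M v k) (M k u)           ∎

    mutate-involutive : ∀ {k u v} → u ≢ k → v ≢ k → mutate k (mutate k M) u v ≡ M u v
    mutate-involutive {k} {u} {v} u≢k v≢k = begin
      mutate k (mutate k M) u v
        ≡⟨ mutate-off-pivot (mutate k M) u≢k v≢k ⟩
      mutate k M u v + pathWeight (mutate k M u k) (mutate k M k v)
        ≡⟨ cong₂ (λ a b → mutate k M u v + pathWeight a b) (mutate-pivotʳ M k u) (mutate-pivotˡ M k v) ⟩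
      mutate k M u v + pathWeight (- M u k) (- M k v)
        ≡⟨ cong₂ _+_ (mutate-off-pivot M u≢k v≢k) (pathWeight-neg (M u k) (M k v)) ⟩
      (M u v + w) + - w   ≡⟨ +-assoc (M u v) w (- w) ⟩
      M u v + (w + - w)   ≡⟨ cong (_+_ (M u v)) (+-inverseʳ w) ⟩
      M u v + + 0         ≡⟨ +-identityʳ (M u v) ⟩
      M u v               ∎
      where
      open ≡-Reasoning
      w : ℤ
      w = pathWeight (M u k) (M k v)

    ascent-swap : ∀ {k a b} → Ascent M k a b → Ascent M k b a
    ascent-swap {k} {a} {b} = subst₂ ℕ._<_ (∣M∣≡∣Mᵀ∣ skew a b) (∣M∣≡∣Mᵀ∣ (mutate-skew k) a b)

    descent-swap : ∀ {k a b} → Descent M k a b → Descent M k b a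
    descent-swap {k} {a} {b} = subst₂ ℕ._<_ (∣M∣≡∣Mᵀ∣ (mutate-skew k) a b) (∣M∣≡∣Mᵀ∣ skew a b)

    ascent⇒mutate-descent : ∀ {k u v} → u ≢ k → v ≢ k → Ascent M k u v → Descent (mutate k M) k u v
    ascent⇒mutate-descent {k} {u} {v} u≢k v≢k =
      subst (λ t → ∣ t ∣ ℕ.< ∣ mutate k M u v ∣) (sym (mutate-involutive u≢k v≢k))

  module _ {M : Matrix n} (large : LargeWeights M) where

    large⇒≢0 : ∀ {u v} → u ≢ v → M u v ≢ + 0
    large⇒≢0 {u} {v} u≢v Muv≡0 with subst (λ t → 2 ℕ.≤ ∣ t ∣) Muv≡0 (large u v u≢v)
    ... | ()

    large⇒sign : ∀ {u v} → u ≢ v → + 0 < M u v ⊎ M u v < + 0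
    large⇒sign u≢v = nonzero-sign _ (large⇒≢0 u≢v)

    large⇒nonneg⇒pos : ∀ {u v} → u ≢ v → + 0 ≤ M u v → + 0 < M u v
    large⇒nonneg⇒pos u≢v 0≤Muv = ≤∧≢⇒< 0≤Muv (≢-sym (large⇒≢0 u≢v))

    large⇒vortex-weights-nonzero : ∀ {a x y z} → Distinct4 a x y z →
      M a x ≢ + 0 × M a y ≢ + 0 × M a z ≢ + 0 × M x y ≢ + 0 × M y z ≢ + 0 × M x z ≢ + 0
    large⇒vortex-weights-nonzero (a≢x , a≢y , a≢z , x≢y , y≢z , x≢z) =
      large⇒≢0 a≢x , large⇒≢0 a≢y , large⇒≢0 a≢z , large⇒≢0 x≢y , large⇒≢0 y≢z , large⇒≢0 x≢z

  Among : Fin n → Fin n → Fin n → Fin n → Set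
  Among w x y z = w ≡ x ⊎ w ≡ y ⊎ w ≡ z

  among? : ∀ w x y z → Among w x y z ⊎ (w ≢ x × w ≢ y × w ≢ z)
  among? w x y z with w ≟ x | w ≟ y | w ≟ z
  ... | yes w≡x | _       | _       = inj₁ (inj₁ w≡x)
  ... | no  _   | yes w≡y | _       = inj₁ (inj₂ (inj₁ w≡y))
  ... | no  _   | no  _   | yes w≡z = inj₁ (inj₂ (inj₂ w≡z))
  ... | no  w≢x | no  w≢y | no  w≢z = inj₂ (w≢x , w≢y , w≢z)

  select : ∀ (P : Fin n → Set) {w x y z} → Among w x y z → P x × P y × P z → P w
  select _ (inj₁ refl)         (px , _ , _)  = px
  select _ (inj₂ (inj₁ refl))  (_ , py , _)  = py
  select _ (inj₂ (inj₂ refl))  (_ , _ , pz)  = pz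

  HasCyclicTriangle : Matrix n → Set
  HasCyclicTriangle M = ∃[ x ] ∃[ y ] ∃[ z ] (Distinct3 x y z × Cyclic M x y z)

  module _ (M : Matrix n) where

    Cyclic-swap : ∀ {x y z} → Cyclic M x y z → Cyclic M y x z
    Cyclic-swap (inj₁ (xy , yz , zx)) = inj₂ (xy , zx , yz)
    Cyclic-swap (inj₂ (yx , zy , xz)) = inj₁ (yx , xz , zy)

    Cyclic-rotate : ∀ {x y z} → Cyclic M x y z → Cyclic M z x y
    Cyclic-rotate (inj₁ (xy , yz , zx)) = inj₁ (zx , xy , yz)
    Cyclic-rotate (inj₂ (yx , zy , xz)) = inj₂ (xz , yx , zy)

    cyclic⇒in-out-neighbours : ∀ {j x y z} → Cyclic M x y z → Among j x y z →
      ∃[ u ] ∃[ v ] (Among u x y z × Among v x y z × + 0 < M u j × + 0 < M j v)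
    cyclic⇒in-out-neighbours {x = x} {y} {z} (inj₁ (xy , yz , zx)) (inj₁ refl) =
      z , y , inj₂ (inj₂ refl) , inj₂ (inj₁ refl) , zx , xy
    cyclic⇒in-out-neighbours {x = x} {y} {z} (inj₁ (xy , yz , zx)) (inj₂ (inj₁ refl)) =
      x , z , inj₁ refl , inj₂ (inj₂ refl) , xy , yz
    cyclic⇒in-out-neighbours {x = x} {y} {z} (inj₁ (xy , yz , zx)) (inj₂ (inj₂ refl)) =
      y , x , inj₂ (inj₁ refl) , inj₁ refl , yz , zx
    cyclic⇒in-out-neighbours {x = x} {y} {z} (inj₂ (yx , zy , xz)) (inj₁ refl) =
      y , z , inj₂ (inj₁ refl) , inj₂ (inj₂ refl) , yx , xz
    cyclic⇒in-out-neighbours {x = x} {y} {z} (inj₂ (yx , zy , xz)) (inj₂ (inj₁ refl)) =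
      z , x , inj₂ (inj₂ refl) , inj₁ refl , zy , yx
    cyclic⇒in-out-neighbours {x = x} {y} {z} (inj₂ (yx , zy , xz)) (inj₂ (inj₂ refl)) =
      x , y , inj₁ refl , inj₂ (inj₁ refl) , xz , zy

  module _ {M : Matrix n} (skew : SkewSymmetric M) (large : LargeWeights M) where

    oriented-descent⇒ascents : ∀ {k a b} → + 0 < M k a → + 0 < M a b → + 0 < M b k →
      Descent M k a b → Ascent M a k b × Ascent M b k a
    oriented-descent⇒ascents {k} {a} {b} ka ab bk descent =
      let (atA , atB) = triangle-descent⇒ascents ka ab bk (large k a k≢a) (large b k b≢k)
                                                 (∣∣<-congˡ μk descent)
      in ∣∣<-congˡ (sym (skew k b)) (∣∣<-congʳ (sym μa) atA) , ∣∣<-congʳ (sym μb) atB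
      where
      k≢a : k ≢ a
      k≢a = pos⇒≢ skew ka
      a≢b : a ≢ b
      a≢b = pos⇒≢ skew ab
      b≢k : b ≢ k
      b≢k = pos⇒≢ skew bk
      μk : mutate k M a b ≡ M a b + pathWeight (- M k a) (- M b k)
      μk = trans (mutate-off-pivot M (≢-sym k≢a) b≢k)
                 (cong₂ (λ s t → M a b + pathWeight s t) (skew a k) (skew k b))
      μa : mutate a M k b ≡ - M b k + pathWeight (M k a) (M a b)
      μa = trans (mutate-off-pivot M k≢a (≢-sym a≢b)) (cong (_+ pathWeight (M k a) (M a b)) (skew k b))
      μb : mutate b M k a ≡ M k a + pathWeight (- M b k) (- M a b)
      μb = trans (mutate-off-pivot M (≢-sym b≢k) a≢b)
                 (cong₂ (λ s t → M k a + pathWeight s t) (skew k b) (skew b a))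

    cyclic-descent⇒ascent : ∀ {k a b} → Cyclic M k a b → Descent M k a b → Ascent M a k b
    cyclic-descent⇒ascent (inj₁ (ka , ab , bk)) descent = proj₁ (oriented-descent⇒ascents ka ab bk descent)
    cyclic-descent⇒ascent (inj₂ (ak , ba , kb)) descent =
      proj₂ (oriented-descent⇒ascents kb ba ak (descent-swap skew descent))

    descent-elsewhere⇒ascent : ∀ {w j u v} → w ≢ j → Cyclic M j u v → HasDescentAt M w j u v →
                               Ascent M j u v
    descent-elsewhere⇒ascent w≢j _ (inj₁ (w≡j , _))               = ⊥-elim (w≢j w≡j)
    descent-elsewhere⇒ascent _   c (inj₂ (inj₁ (refl , descent))) =
      cyclic-descent⇒ascent (Cyclic-swap M c) descent
    descent-elsewhere⇒ascent _   c (inj₂ (inj₂ (refl , descent))) =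
      ascent-swap skew (cyclic-descent⇒ascent (Cyclic-rotate M c) descent)

    globalDescent⇒condA : ∀ {w j} → GlobalDescent M w → w ≢ j → CondA M j
    globalDescent⇒condA (_ , descent) w≢j u v d c = descent-elsewhere⇒ascent w≢j c (descent _ u v d c)

    vortexFree⇒condB : VortexFree M → HasCyclicTriangle M → ∀ j → CondB M j
    vortexFree⇒condB vortexFree (x , y , z , d , c) j with among? j x y z
    ... | inj₁ j∈xyz =
      let (_ , _ , _ , _ , uj , jv) = cyclic⇒in-out-neighbours M c j∈xyz
      in out-neighbour⇒¬sink skew jv , in-neighbour⇒¬source skew uj
    ... | inj₂ (j≢x , j≢y , j≢z) =
      (λ sink → apex (inj₁ (sink x (≢-sym j≢x) , sink y (≢-sym j≢y) , sink z (≢-sym j≢z)))) ,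
      (λ source → apex (inj₂ (source x (≢-sym j≢x) , source y (≢-sym j≢y) , source z (≢-sym j≢z))))
      where
      d₄ : Distinct4 j x y z
      d₄ = j≢x , j≢y , j≢z , d
      apex : (x ⇢ j within M × y ⇢ j within M × z ⇢ j within M)
             ⊎ (j ⇢ x within M × j ⇢ y within M × j ⇢ z within M) → ⊥
      apex sinkOrSource = vortexFree j x y z d₄ (large⇒vortex-weights-nonzero large d₄ , sinkOrSource , c)

    condsGV⇒condsABC : ∀ {j} → CondsGV M j → CondsABC M j
    condsGV⇒condsABC {j} ((w , w≢j , globalDescent) , vortexFree) =
      globalDescent⇒condA globalDescent w≢j ,
      vortexFree⇒condB vortexFree (proj₁ globalDescent) j ,
      λ (x , y , z , d₄ , vortex) → vortexFree j x y z d₄ vortex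

  -- B is the paper's Q, and Q = mutate i B its Q′.
  module AscentAtPivot {B : Matrix n} {i : Fin n} (skew : SkewSymmetric B) (large : LargeWeights B)
                       (ascent : CondA B i) (noApex : CondC B i) where

    Q : Matrix n
    Q = mutate i B

    Q-skew : SkewSymmetric Q
    Q-skew = mutate-skew skew i

    Q-row : ∀ u → Q i u ≡ B u i
    Q-row u = trans (mutate-pivotˡ B i u) (-M≡Mᵀ skew i u)

    Q-col : ∀ u → Q u i ≡ B i u
    Q-col u = trans (mutate-pivotʳ B i u) (-M≡Mᵀ skew u i)

    Q-unchanged : ∀ {u v} → u ≢ i → v ≢ i → pathWeight (B u i) (B i v) ≡ + 0 → Q u v ≡ B u v
    Q-unchanged {u} {v} u≢i v≢i w≡0 =
      trans (mutate-off-pivot B u≢i v≢i) (trans (cong (_+_ (B u v)) w≡0) (+-identityʳ (B u v)))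

    both-into-i⇒Q-unchanged : ∀ {u v} → + 0 < B u i → + 0 < B v i → Q u v ≡ B u v
    both-into-i⇒Q-unchanged ui vi = Q-unchanged (pos⇒≢ skew ui) (pos⇒≢ skew vi)
      (pathWeight-≥0-≤0 (<⇒≤ ui) (<⇒≤ (pos⇒negᵀ skew vi)))

    both-out-of-i⇒Q-unchanged : ∀ {u v} → + 0 < B i u → + 0 < B i v → Q u v ≡ B u v
    both-out-of-i⇒Q-unchanged iu iv = Q-unchanged (≢-sym (pos⇒≢ skew iu)) (≢-sym (pos⇒≢ skew iv))
      (pathWeight-≤0-≥0 (<⇒≤ (pos⇒negᵀ skew iu)) (<⇒≤ iv))

    Q-path : ∀ {u v} → + 0 < B u i → + 0 < B i v → Q u v ≡ B u v + pathWeight (B u i) (B i v)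
    Q-path ui iv = mutate-off-pivot B (pos⇒≢ skew ui) (≢-sym (pos⇒≢ skew iv))

    path⇒ascent : ∀ {u v} → + 0 < B u i → + 0 < B i v → Ascent B i u v
    path⇒ascent {u} {v} ui iv with + 0 ≤ℤ? B u v
    ... | yes 0≤uv = ∣∣<-congʳ (sym (Q-path ui iv)) (∣i∣<∣i+j∣ 0≤uv (pathWeight-pos ui iv))
    ... | no  0≰uv = ascent u v (cyclic⇒distinct skew closed) closed
      where
      closed : Cyclic B i u v
      closed = inj₂ (ui , neg⇒posᵀ skew (≰⇒> 0≰uv) , iv)

    path⇒Q-pos : ∀ {u v} → + 0 < B u i → + 0 < B i v → + 0 < Q u v
    path⇒Q-pos {u} {v} ui iv = subst (+ 0 <_) (sym (Q-path ui iv))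
      (∣i∣<∣i+j∣⇒0<i+j {B u v} (pathWeight-pos ui iv) (∣∣<-congʳ (Q-path ui iv) (path⇒ascent ui iv)))

    Q-path-closes : ∀ {u v} → + 0 < Q u i → + 0 < Q i v → + 0 < Q v u
    Q-path-closes {u} {v} ui iv = path⇒Q-pos (subst (+ 0 <_) (Q-row v) iv) (subst (+ 0 <_) (Q-col u) ui)

    path⇒Q-cyclic : ∀ {u v} → + 0 < B u i → + 0 < B i v → Cyclic Q i u v
    path⇒Q-cyclic {u} {v} ui iv =
      inj₁ (subst (+ 0 <_) (sym (Q-row u)) ui , path⇒Q-pos ui iv , subst (+ 0 <_) (sym (Q-col v)) iv)

    weights-nondecreasing : ∀ u v → ∣ B u v ∣ ℕ.≤ ∣ Q u v ∣
    weights-nondecreasing u v = by-cases (u ≟ i) (v ≟ i)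
      where
      by-cases : Dec (u ≡ i) → Dec (v ≡ i) → ∣ B u v ∣ ℕ.≤ ∣ Q u v ∣
      by-cases (yes refl) _ =
        ℕP.≤-reflexive (sym (trans (cong ∣_∣ (mutate-pivotˡ B u v)) (∣-i∣≡∣i∣ (B u v))))
      by-cases (no _) (yes refl) =
        ℕP.≤-reflexive (sym (trans (cong ∣_∣ (mutate-pivotʳ B v u)) (∣-i∣≡∣i∣ (B u v))))
      by-cases (no u≢i) (no v≢i) with pathWeight-cases (B u i) (B i v)
      ... | inj₁ (ui , iv)               = ℕP.<⇒≤ (path⇒ascent ui iv)
      ... | inj₂ (inj₁ (ui<0 , iv<0))    =
        ℕP.<⇒≤ (ascent-swap {M = B} skew {a = v}
                 (path⇒ascent (neg⇒posᵀ skew iv<0) (neg⇒posᵀ skew ui<0)))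
      ... | inj₂ (inj₂ w≡0)              = ℕP.≤-reflexive (sym (cong ∣_∣ (Q-unchanged u≢i v≢i w≡0)))

    Q-large : LargeWeights Q
    Q-large = large-mono {M = B} {M′ = Q} large weights-nondecreasing

    sign-towards-i : ∀ {u} → u ≢ i → + 0 < B u i ⊎ B u i < + 0
    sign-towards-i = large⇒sign {M = B} large

    no-reverse-path : ∀ {u v} → + 0 < Q u v → + 0 < B v i → ¬ (+ 0 < B i u)
    no-reverse-path {u} {v} uv vi iu = pos⇒¬nonnegᵀ Q-skew {u} {v} uv (<⇒≤ (path⇒Q-pos vi iu))

    into-i-propagates-back : ∀ {u v} → + 0 < Q u v → u ≢ i → + 0 < B v i → + 0 < B u i
    into-i-propagates-back uv u≢i vi with sign-towards-i u≢i
    ... | inj₁ ui   = ui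
    ... | inj₂ ui<0 = ⊥-elim (no-reverse-path uv vi (neg⇒posᵀ skew ui<0))

    out-of-i-propagates : ∀ {u v} → + 0 < Q u v → v ≢ i → + 0 < B i u → + 0 < B i v
    out-of-i-propagates uv v≢i iu with sign-towards-i v≢i
    ... | inj₁ vi   = ⊥-elim (no-reverse-path uv vi iu)
    ... | inj₂ vi<0 = neg⇒posᵀ skew vi<0

    AllOnOneSideOf-i : Fin n → Fin n → Fin n → Set
    AllOnOneSideOf-i x y z =
      (+ 0 < B x i × + 0 < B y i × + 0 < B z i) ⊎ (+ 0 < B i x × + 0 < B i y × + 0 < B i z)

    Q-cycle-avoiding-i⇒one-side : ∀ {x y z} → x ≢ i → y ≢ i → z ≢ i →
      + 0 < Q x y → + 0 < Q y z → + 0 < Q z x → AllOnOneSideOf-i x y z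
    Q-cycle-avoiding-i⇒one-side x≢i y≢i z≢i xy yz zx with sign-towards-i x≢i
    ... | inj₁ xi =
      let zi = into-i-propagates-back zx z≢i xi
          yi = into-i-propagates-back yz y≢i zi
      in inj₁ (xi , yi , zi)
    ... | inj₂ xi<0 =
      let ix = neg⇒posᵀ skew xi<0
          iy = out-of-i-propagates xy y≢i ix
          iz = out-of-i-propagates yz z≢i iy
      in inj₂ (ix , iy , iz)

    ¬Q-cycle-avoiding-i : ∀ {x y z} → x ≢ i → y ≢ i → z ≢ i →
      + 0 < Q x y → + 0 < Q y z → + 0 < Q z x → ⊥
    ¬Q-cycle-avoiding-i {x} {y} {z} x≢i y≢i z≢i xy yz zx =
      noApex (x , y , z , d₄ , large⇒vortex-weights-nonzero large d₄ ,
              vortex-at-i (Q-cycle-avoiding-i⇒one-side x≢i y≢i z≢i xy yz zx))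
      where
      d₄ : Distinct4 i x y z
      d₄ = ≢-sym x≢i , ≢-sym y≢i , ≢-sym z≢i , cyclic⇒distinct Q-skew (inj₁ (xy , yz , zx))
      vortex-at-i : AllOnOneSideOf-i x y z →
        ((x ⇢ i within B × y ⇢ i within B × z ⇢ i within B)
         ⊎ (i ⇢ x within B × i ⇢ y within B × i ⇢ z within B)) × Cyclic B x y z
      vortex-at-i (inj₁ (xi , yi , zi)) =
        inj₁ (<⇒≤ xi , <⇒≤ yi , <⇒≤ zi) ,
        inj₁ ( subst (+ 0 <_) (both-into-i⇒Q-unchanged xi yi) xy
             , subst (+ 0 <_) (both-into-i⇒Q-unchanged yi zi) yz
             , subst (+ 0 <_) (both-into-i⇒Q-unchanged zi xi) zx)
      vortex-at-i (inj₂ (ix , iy , iz)) =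
        inj₂ (<⇒≤ ix , <⇒≤ iy , <⇒≤ iz) ,
        inj₁ ( subst (+ 0 <_) (both-out-of-i⇒Q-unchanged ix iy) xy
             , subst (+ 0 <_) (both-out-of-i⇒Q-unchanged iy iz) yz
             , subst (+ 0 <_) (both-out-of-i⇒Q-unchanged iz ix) zx)

    Q-cyclic⇒∋i : ∀ {x y z} → Cyclic Q x y z → Among i x y z
    Q-cyclic⇒∋i {x} {y} {z} c with among? i x y z
    ... | inj₁ i∈xyz = i∈xyz
    ... | inj₂ (i≢x , i≢y , i≢z) with c
    ...   | inj₁ (xy , yz , zx) =
      ⊥-elim (¬Q-cycle-avoiding-i (≢-sym i≢x) (≢-sym i≢y) (≢-sym i≢z) xy yz zx)
    ...   | inj₂ (yx , zy , xz) =
      ⊥-elim (¬Q-cycle-avoiding-i (≢-sym i≢x) (≢-sym i≢z) (≢-sym i≢y) xz zy yx)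

    Q-cyclic∋i⇒B-ascent : ∀ {u v} → Cyclic Q i u v → Ascent B i u v
    Q-cyclic∋i⇒B-ascent {u} {v} (inj₁ (iu , uv , vi)) =
      path⇒ascent (subst (+ 0 <_) (Q-row u) iu) (subst (+ 0 <_) (Q-col v) vi)
    Q-cyclic∋i⇒B-ascent {u} {v} (inj₂ (ui , vu , iv)) =
      ascent-swap {M = B} skew {a = v}
        (path⇒ascent (subst (+ 0 <_) (Q-row v) iv) (subst (+ 0 <_) (Q-col u) ui))

    Q-cyclic∋i⇒descent : ∀ {u v} → Cyclic Q i u v → Descent Q i u v
    Q-cyclic∋i⇒descent c =
      let (i≢u , _ , i≢v) = cyclic⇒distinct Q-skew c
      in ascent⇒mutate-descent skew (≢-sym i≢u) (≢-sym i≢v) (Q-cyclic∋i⇒B-ascent c)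

    Q-descent-at-i : ∀ {x y z} → Cyclic Q x y z → HasDescentAt Q i x y z
    Q-descent-at-i {x} {y} {z} c with Q-cyclic⇒∋i {x} {y} {z} c
    ... | inj₁ refl        = inj₁ (refl , Q-cyclic∋i⇒descent {y} {z} c)
    ... | inj₂ (inj₁ refl) =
      inj₂ (inj₁ (refl , Q-cyclic∋i⇒descent {x} {z} (Cyclic-swap Q {x} {i} {z} c)))
    ... | inj₂ (inj₂ refl) =
      inj₂ (inj₂ (refl , Q-cyclic∋i⇒descent {x} {y} (Cyclic-rotate Q {x} {y} {i} c)))

    Q-vortexFree : VortexFree Q
    Q-vortexFree a x y z (a≢x , a≢y , a≢z , _) (_ , apex , c) with Q-cyclic⇒∋i c
    ... | i∈xyz with cyclic⇒in-out-neighbours Q c i∈xyz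
    ...   | u , v , u∈xyz , v∈xyz , ui , iv = [ ¬sink , ¬source ]′ apex
      where
      a≢i : a ≢ i
      a≢i = select (a ≢_) i∈xyz (a≢x , a≢y , a≢z)
      ¬sink : ¬ (x ⇢ a within Q × y ⇢ a within Q × z ⇢ a within Q)
      ¬sink sink = pos⇒¬nonnegᵀ Q-skew {a} {u} (Q-path-closes {u} {a} ui ia) (into-a u∈xyz)
        where
        into-a : ∀ {w} → Among w x y z → w ⇢ a within Q
        into-a w∈xyz = select (λ t → t ⇢ a within Q) w∈xyz sink
        ia : + 0 < Q i a
        ia = large⇒nonneg⇒pos {M = Q} Q-large (≢-sym a≢i) (into-a i∈xyz)
      ¬source : ¬ (a ⇢ x within Q × a ⇢ y within Q × a ⇢ z within Q)
      ¬source source = pos⇒¬nonnegᵀ Q-skew {v} {a} (Q-path-closes {a} {v} ai iv) (out-of-a v∈xyz)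
        where
        out-of-a : ∀ {w} → Among w x y z → a ⇢ w within Q
        out-of-a w∈xyz = select (λ t → a ⇢ t within Q) w∈xyz source
        ai : + 0 < Q a i
        ai = large⇒nonneg⇒pos {M = Q} Q-large a≢i (out-of-a i∈xyz)

    mutation-outcome : CondB B i → GlobalDescent Q i × VortexFree Q × WeightsIncrease B Q
    mutation-outcome (¬sink , ¬source) =
      let (u , ui) = ¬source⇒in-neighbour skew ¬source
          (v , iv) = ¬sink⇒out-neighbour skew ¬sink
          cycle = path⇒Q-cyclic ui iv
      in ((i , u , v , cyclic⇒distinct Q-skew cycle , cycle) , λ _ _ _ _ → Q-descent-at-i) ,
         Q-vortexFree ,
         (weights-nondecreasing , u , v , path⇒ascent ui iv)

corollary6p9 : ∀ {n} (B : Matrix n) (i i' : Fin n)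
    → SkewSymmetric B → LargeWeights B → i ≢ i'
    → (CondsABC B i → CondsABC (mutate i B) i'
                       × GlobalDescent (mutate i B) i
                       × WeightsIncrease B (mutate i B))
      × (CondsGV B i → CondsGV (mutate i B) i'
                       × GlobalDescent (mutate i B) i
                       × WeightsIncrease B (mutate i B))
corollary6p9 {n} B i i' skew large i≢i' = fromABC , fromGV
  where
  Q : Matrix n
  Q = mutate i B

  gv-from-abc : CondsABC B i → CondsGV Q i' × GlobalDescent Q i × WeightsIncrease B Q
  gv-from-abc (ascent , notSinkOrSource , noApex) =
    let (globalDescent , vortexFree , increase) =
          AscentAtPivot.mutation-outcome skew large ascent noApex notSinkOrSource
    in ((i , i≢i' , globalDescent) , vortexFree) , globalDescent , increase

  fromABC : CondsABC B i → CondsABC Q i' × GlobalDescent Q i × WeightsIncrease B Q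
  fromABC abc =
    let (gv , globalDescent , increase) = gv-from-abc abc
        Q-large = large-mono {M = B} {M′ = Q} large (proj₁ increase)
    in condsGV⇒condsABC (mutate-skew skew i) Q-large gv , globalDescent , increase

  fromGV : CondsGV B i → CondsGV Q i' × GlobalDescent Q i × WeightsIncrease B Q
  fromGV gv = gv-from-abc (condsGV⇒condsABC skew large gv)
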